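{- Let $\Gamma$ be a finite nonabelian group with nontrivial center $Z(\Gamma)$, let $\mathscr{C}$ be the collection of all maximal abelian subgroups of $\Gamma$, and suppose the intersection of every two distinct members of $\mathscr{C}$ equals $Z(\Gamma)$. Then (1) $rc(CG(\Gamma))=2$ if and only if $|\mathscr{C}|\leq 2^{|Z(\Gamma)|}$; (2) $rc(CG(\Gamma))=3$ if and only if $|\mathscr{C}|> 2^{|Z(\Gamma)|}$.
   Context: For a finite group $\Gamma$, the commuting graph $CG(\Gamma)$ is the simple graph with vertex set $\Gamma$ in which two distinct elements $a,b$ are adjacent if and only if $ab=ba$. For a connected graph $G$, an edge coloring (adjacent edges may share colors) makes $G$ rainbow-connected if every two distinct vertices are joined by a path whose edges all have pairwise distinct colors; the rainbow connection number $rc(G)$ is the minimum number of colors in such a coloring. $Z(\Gamma)=\{z\in\Gamma: za=az \text{ for all } a\in\Gamma\}$ is the center of $\Gamma$; nontrivial means $Z(\Gamma)\neq\{e\}$. A maximal abelian subgroup of $\Gamma$ is an abelian subgroup not properly contained in any other abelian subgroup of $\Gamma$. -}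

module Defs where

open import Level using (0ℓ)
open import Data.Nat using (ℕ; _<_)
open import Data.Fin using (Fin; _≟_)
open import Data.Fin.Properties using (all?)
open import Data.Fin.Subset using (Subset; _∈_; _⊆_; _∩_; ∣_∣; inside; outside)
open import Data.Vec using (tabulate)
open import Data.List using (List; []; _∷_)
import Data.List.Membership.Propositional as LM
open import Data.List.Relation.Unary.Unique.Propositional using (Unique)
open import Data.Product using (Σ; _×_; ∃)
open import Data.Bool using (if_then_else_)
open import Data.Empty using (⊥)
open import Relation.Nullary using (¬_; does)
open import Relation.Binary.PropositionalEquality using (_≡_; _≢_)
open import Algebra.Structures using (IsGroup)
open import Function.Bundles using (_⇔_)

-- A finite group of order n, realised on the carrier Fin n
-- (every finite group is isomorphic to such a group).
record FinGroup (n : ℕ) : Set where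
  infixl 7 _∙_
  field
    _∙_     : Fin n → Fin n → Fin n
    ε       : Fin n
    _⁻¹     : Fin n → Fin n
    isGroup : IsGroup _≡_ _∙_ ε _⁻¹

module _ {n : ℕ} (Γ : FinGroup n) where
  open FinGroup Γ

  Commute : Fin n → Fin n → Set
  Commute a b = a ∙ b ≡ b ∙ a

  IsAbelianGroup : Set
  IsAbelianGroup = ∀ a b → Commute a b

  center : Subset n
  center = tabulate λ z →
    if does (all? (λ a → (z ∙ a) ≟ (a ∙ z))) then inside else outside

  IsSubgroup : Subset n → Set
  IsSubgroup H = (ε ∈ H)
               × (∀ {a b} → a ∈ H → b ∈ H → (a ∙ b) ∈ H)
               × (∀ {a} → a ∈ H → (a ⁻¹) ∈ H)

  IsAbelianSubgroup : Subset n → Set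
  IsAbelianSubgroup H = IsSubgroup H × (∀ {a b} → a ∈ H → b ∈ H → Commute a b)

  IsMaximalAbelian : Subset n → Set
  IsMaximalAbelian H = IsAbelianSubgroup H
                     × (∀ K → IsAbelianSubgroup K → H ⊆ K → K ≡ H)

  EnumeratesMaxAbelian : List (Subset n) → Set
  EnumeratesMaxAbelian L = Unique L × (∀ H → (H LM.∈ L) ⇔ IsMaximalAbelian H)

  CGAdj : Fin n → Fin n → Set
  CGAdj a b = a ≢ b × Commute a b

module _ {n : ℕ} (Adj : Fin n → Fin n → Set) where

  data Walk : Fin n → Fin n → Set where
    nil  : ∀ {u} → Walk u u
    cons : ∀ {u w v} → Adj u w → Walk w v → Walk u v

  vertices : ∀ {u v} → Walk u v → List (Fin n)
  vertices {u} nil        = u ∷ []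
  vertices {u} (cons _ p) = u ∷ vertices p

  -- an edge colouring with (at most) k colours: a symmetric colour assignment
  -- to pairs of vertices (only its values on edges matter)
  record EdgeColouring (k : ℕ) : Set where
    field
      colour : Fin n → Fin n → Fin k
      sym    : ∀ a b → colour a b ≡ colour b a

  edgeColours : ∀ {k} → EdgeColouring k → ∀ {u v} → Walk u v → List (Fin k)
  edgeColours c nil = []
  edgeColours c (cons {u} {w} _ p) = EdgeColouring.colour c u w ∷ edgeColours c p

  IsRainbowPath : ∀ {k} → EdgeColouring k → ∀ {u v} → Walk u v → Set
  IsRainbowPath c p = Unique (vertices p) × Unique (edgeColours c p)

  IsRainbowConnecting : ∀ {k} → EdgeColouring k → Set
  IsRainbowConnecting c = ∀ u v → u ≢ v → Σ (Walk u v) (IsRainbowPath c)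

  RainbowColourable : ℕ → Set
  RainbowColourable k = Σ (EdgeColouring k) IsRainbowConnecting

  RcIs : ℕ → Set
  RcIs k = RainbowColourable k × (∀ m → m < k → ¬ RainbowColourable m)

{-# OPTIONS --safe #-}
-- Under the hypothesis, a noncentral x lies in a unique maximal abelian
-- subgroup, and that subgroup contains everything commuting with x. So noncommuting
-- u, v are noncentral, and a common neighbour of u and v in CG(Γ) lies in two distinct
-- maximal abelian subgroups, hence in Z. One colour never suffices, three always do
-- (the path u – e – z – v for a central z ≠ e). With two colours a rainbow path from u
-- to v must be u – z – v with z central and colour(u,z) ≠ colour(z,v). Hence noncentral
-- representatives of distinct members of 𝒞 see distinct colour patterns on their
-- edges to Z, giving |𝒞| ≤ 2^|Z|; conversely, when |𝒞| ≤ 2^|Z| one may give each member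
-- of 𝒞 its own pattern and colour the edges from its elements to Z accordingly.
module Submission where

open import Defs
open import Level using (0ℓ)
open import Data.Nat using (ℕ; zero; suc; _∸_; _≤_; _<_; _>_; _^_; s≤s; z≤n)
open import Data.Nat.Induction using (<-wellFounded)
open import Data.Nat.Properties using (∸-monoʳ-<; ≰⇒>; <⇒≱)
open import Data.Fin using (Fin; zero; suc; _≟_; combine; remQuot; inject≤)
open import Data.Fin.Properties
  using (all?; any?; ¬∀⟶∃¬; combine-remQuot; combine-injective; inject≤-injective; injective⇒≤)
open import Data.Fin.Subset using (Subset; _∈_; _∉_; _⊆_; _∩_; _∪_; ∣_∣; inside; outside; ⁅_⁆)
open import Data.Fin.Subset.Properties
  using (_∈?_; anySubset?; _⊂?_; p⊂q⇒∣p∣<∣q∣; ∣p∣≤n; ⊆-antisym; x∈p∩q⁺; x∈p∪q⁺; x∈p∪q⁻; x∈⁅x⁆; x∈⁅y⁆⇒x≡y)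
open import Data.Vec using (_∷_; []; here; there; tabulate)
open import Data.Vec.Properties using (lookup∘tabulate; []=⇒lookup; lookup⇒[]=)
open import Data.Bool using (Bool; true; false; if_then_else_; _∧_; _∨_)
open import Data.Bool.Properties using (∧-comm; ∨-comm)
open import Data.List using (List; length; lookup; _∷_)
open import Data.List.Membership.Propositional.Properties using (∈-lookup)
import Data.List.Relation.Unary.All as All
open import Data.List.Relation.Unary.All using (_∷_; [])
open import Data.List.Relation.Unary.AllPairs using (_∷_; [])
open import Data.List.Relation.Unary.Any using (index)
open import Data.List.Relation.Unary.Any.Properties using (lookup-index)
open import Data.List.Relation.Unary.Unique.Propositional using (Unique)
open import Data.Product using (Σ; ∃; ∃₂; _×_; _,_; proj₁; proj₂)
open import Data.Sum using (_⊎_; inj₁; inj₂)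
import Data.Sum as Sum
open import Data.Empty using (⊥-elim)
open import Function using (_∘_)
open import Function.Bundles using (_⇔_; mk⇔; Equivalence)
import Function.Properties.Equivalence as ⇔
open import Induction.WellFounded using (Acc; acc)
open import Relation.Nullary using (¬_; Dec; yes; no; does)
open import Relation.Nullary.Decidable using (_×-dec_; _→-dec_; ¬?; map′; decidable-stable; dec-true; dec-false)
open import Relation.Unary using (Pred; Decidable)
open import Relation.Binary.PropositionalEquality
open import Algebra.Structures using (IsGroup)

module _ {n : ℕ} {P : Pred (Fin n) 0ℓ} (P? : Decidable P) where

  select : Subset n
  select = tabulate λ x → if does (P? x) then inside else outside

  ∈-select⁺ : ∀ {x} → P x → x ∈ select
  ∈-select⁺ {x} px = lookup⇒[]= x select
    (trans (lookup∘tabulate _ x) (cong (if_then inside else outside) (dec-true (P? x) px)))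

  ∈-select⁻ : ∀ {x} → x ∈ select → P x
  ∈-select⁻ {x} x∈ with P? x | trans (sym (lookup∘tabulate _ x)) ([]=⇒lookup x∈)
  ... | yes px | _  = px
  ... | no _   | ()

module _ {k : ℕ} where

  encodeOn : ∀ {n} (q : Subset n) → (Fin n → Fin (suc k)) → Fin (suc k ^ ∣ q ∣)
  encodeOn []            f = zero
  encodeOn (outside ∷ q) f = encodeOn q (f ∘ suc)
  encodeOn (inside ∷ q)  f = combine (f zero) (encodeOn q (f ∘ suc))

  -- off q the decoded function is junk (constantly zero)
  decodeOn : ∀ {n} (q : Subset n) → Fin (suc k ^ ∣ q ∣) → Fin n → Fin (suc k)
  decodeOn (outside ∷ q) c zero    = zero
  decodeOn (outside ∷ q) c (suc i) = decodeOn q c i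
  decodeOn (inside ∷ q)  c zero    = proj₁ (remQuot {suc k} (suc k ^ ∣ q ∣) c)
  decodeOn (inside ∷ q)  c (suc i) = decodeOn q (proj₂ (remQuot {suc k} (suc k ^ ∣ q ∣) c)) i

  encodeOn-decodeOn : ∀ {n} (q : Subset n) c → encodeOn q (decodeOn q c) ≡ c
  encodeOn-decodeOn []            zero = refl
  encodeOn-decodeOn (outside ∷ q) c    = encodeOn-decodeOn q c
  encodeOn-decodeOn (inside ∷ q)  c    =
    trans (cong (combine (decodeOn (inside ∷ q) c zero)) (encodeOn-decodeOn q _))
          (combine-remQuot {suc k} (suc k ^ ∣ q ∣) c)

  encodeOn-cong : ∀ {n} (q : Subset n) {f g} → (∀ i → i ∈ q → f i ≡ g i) →
                  encodeOn q f ≡ encodeOn q g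
  encodeOn-cong []            f≗g = refl
  encodeOn-cong (outside ∷ q) f≗g = encodeOn-cong q λ i i∈ → f≗g (suc i) (there i∈)
  encodeOn-cong (inside ∷ q)  f≗g =
    cong₂ combine (f≗g zero here) (encodeOn-cong q λ i i∈ → f≗g (suc i) (there i∈))

  encodeOn-injective : ∀ {n} (q : Subset n) {f g} → encodeOn q f ≡ encodeOn q g →
                       ∀ {i} → i ∈ q → f i ≡ g i
  encodeOn-injective (outside ∷ q) eq (there i∈) = encodeOn-injective q eq i∈
  encodeOn-injective (inside ∷ q) {f} {g} eq here =
    proj₁ (combine-injective (f zero) _ (g zero) _ eq)
  encodeOn-injective (inside ∷ q) {f} {g} eq (there i∈) =
    encodeOn-injective q (proj₂ (combine-injective (f zero) _ (g zero) _ eq)) i∈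

  decodeOn-separates : ∀ {n} (q : Subset n) {c d} → c ≢ d →
                       ∃ λ i → i ∈ q × decodeOn q c i ≢ decodeOn q d i
  decodeOn-separates {n} q {c} {d} c≢d
    with ¬∀⟶∃¬ n _ (λ i → i ∈? q →-dec decodeOn q c i ≟ decodeOn q d i) ¬agree
    where
    ¬agree : ¬ (∀ i → i ∈ q → decodeOn q c i ≡ decodeOn q d i)
    ¬agree agree = c≢d (begin
      c                           ≡⟨ encodeOn-decodeOn q c ⟨
      encodeOn q (decodeOn q c)   ≡⟨ encodeOn-cong q agree ⟩
      encodeOn q (decodeOn q d)   ≡⟨ encodeOn-decodeOn q d ⟩
      d                           ∎)
      where open ≡-Reasoning
  ... | i , disagree =
    i , decidable-stable (i ∈? q) (λ i∉q → disagree (⊥-elim ∘ i∉q)) , λ eq → disagree λ _ → eq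

lookup-injective : ∀ {a} {A : Set a} {xs : List A} → Unique xs →
                   ∀ {i j} → lookup xs i ≡ lookup xs j → i ≡ j
lookup-injective {xs = _ ∷ _}  _            {zero}  {zero}  _  = refl
lookup-injective {xs = _ ∷ _}  (x∉xs ∷ _)   {zero}  {suc j} eq = ⊥-elim (All.lookup x∉xs (∈-lookup j) eq)
lookup-injective {xs = _ ∷ _}  (x∉xs ∷ _)   {suc i} {zero}  eq = ⊥-elim (All.lookup x∉xs (∈-lookup i) (sym eq))
lookup-injective {xs = _ ∷ _}  (_ ∷ unique) {suc i} {suc j} eq = cong suc (lookup-injective unique eq)

Unique⇒length≤ : ∀ {k} {xs : List (Fin k)} → Unique xs → length xs ≤ k
Unique⇒length≤ unique = injective⇒≤ (lookup-injective unique)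

module _ {n : ℕ} (Γ : FinGroup n) where
  open FinGroup Γ
  open IsGroup isGroup using (assoc; identityˡ; identityʳ; inverseˡ; inverseʳ)
  open ≡-Reasoning

  private
    Z : Subset n
    Z = center Γ

  Commute? : ∀ a b → Dec (Commute Γ a b)
  Commute? a b = (a ∙ b) ≟ (b ∙ a)

  commute-εˡ : ∀ a → Commute Γ ε a
  commute-εˡ a = trans (identityˡ a) (sym (identityʳ a))

  commute-∙ˡ : ∀ {a b x} → Commute Γ a x → Commute Γ b x → Commute Γ (a ∙ b) x
  commute-∙ˡ {a} {b} {x} ax bx = begin
    (a ∙ b) ∙ x ≡⟨ assoc a b x ⟩
    a ∙ (b ∙ x) ≡⟨ cong (a ∙_) bx ⟩
    a ∙ (x ∙ b) ≡⟨ sym (assoc a x b) ⟩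
    (a ∙ x) ∙ b ≡⟨ cong (_∙ b) ax ⟩
    (x ∙ a) ∙ b ≡⟨ assoc x a b ⟩
    x ∙ (a ∙ b) ∎

  commute-⁻¹ˡ : ∀ {a x} → Commute Γ a x → Commute Γ (a ⁻¹) x
  commute-⁻¹ˡ {a} {x} ax = begin
    a ⁻¹ ∙ x                 ≡⟨ sym (identityʳ _) ⟩
    (a ⁻¹ ∙ x) ∙ ε           ≡⟨ cong ((a ⁻¹ ∙ x) ∙_) (sym (inverseʳ a)) ⟩
    (a ⁻¹ ∙ x) ∙ (a ∙ a ⁻¹)  ≡⟨ sym (assoc _ a _) ⟩
    ((a ⁻¹ ∙ x) ∙ a) ∙ a ⁻¹  ≡⟨ cong (_∙ a ⁻¹) (assoc _ x a) ⟩
    (a ⁻¹ ∙ (x ∙ a)) ∙ a ⁻¹  ≡⟨ cong (λ t → (a ⁻¹ ∙ t) ∙ a ⁻¹) (sym ax) ⟩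
    (a ⁻¹ ∙ (a ∙ x)) ∙ a ⁻¹  ≡⟨ cong (_∙ a ⁻¹) (sym (assoc _ a x)) ⟩
    ((a ⁻¹ ∙ a) ∙ x) ∙ a ⁻¹  ≡⟨ cong (λ t → (t ∙ x) ∙ a ⁻¹) (inverseˡ a) ⟩
    (ε ∙ x) ∙ a ⁻¹           ≡⟨ cong (_∙ a ⁻¹) (identityˡ x) ⟩
    x ∙ a ⁻¹                 ∎

  ¬commute⇒≢ : ∀ {a b} → ¬ Commute Γ a b → a ≢ b
  ¬commute⇒≢ ¬ab refl = ¬ab refl

  nonabelian⇒noncommuting : ¬ IsAbelianGroup Γ → ∃₂ λ a b → ¬ Commute Γ a b
  nonabelian⇒noncommuting nonabelian with ¬∀⟶∃¬ n _ (λ a → all? (Commute? a)) nonabelian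
  ... | a , ¬∀b with ¬∀⟶∃¬ n _ (Commute? a) ¬∀b
  ... | b , ¬ab = a , b , ¬ab

  ∈center⁻ : ∀ {z} → z ∈ Z → ∀ a → Commute Γ z a
  ∈center⁻ = ∈-select⁻ λ z → all? λ a → Commute? z a

  ∈center⁺ : ∀ {z} → (∀ a → Commute Γ z a) → z ∈ Z
  ∈center⁺ = ∈-select⁺ λ z → all? λ a → Commute? z a

  ε∈center : ε ∈ Z
  ε∈center = ∈center⁺ commute-εˡ

  ¬commute⇒∉center : ∀ {u v} → ¬ Commute Γ u v → u ∉ Z
  ¬commute⇒∉center ¬uv u∈Z = ¬uv (∈center⁻ u∈Z _)

  nonabelian⇒noncentral : ¬ IsAbelianGroup Γ → ∃ λ a → a ∉ Z
  nonabelian⇒noncentral nonabelian with nonabelian⇒noncommuting nonabelian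
  ... | a , _ , ¬ab = a , ¬commute⇒∉center ¬ab

  ∉center⇒≢∈center : ∀ {u z} → u ∉ Z → z ∈ Z → u ≢ z
  ∉center⇒≢∈center u∉Z z∈Z refl = u∉Z z∈Z

  centralizer : Subset n → Subset n
  centralizer S = select λ x → all? λ s → s ∈? S →-dec Commute? x s

  ∈centralizer⁺ : ∀ {S x} → (∀ s → s ∈ S → Commute Γ x s) → x ∈ centralizer S
  ∈centralizer⁺ {S} = ∈-select⁺ λ x → all? λ s → s ∈? S →-dec Commute? x s

  ∈centralizer⁻ : ∀ {S x s} → x ∈ centralizer S → s ∈ S → Commute Γ x s
  ∈centralizer⁻ {S} {x} {s} x∈ = ∈-select⁻ (λ x → all? λ s → s ∈? S →-dec Commute? x s) x∈ s

  centralizer-isSubgroup : ∀ S → IsSubgroup Γ (centralizer S)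
  centralizer-isSubgroup S =
      ∈centralizer⁺ (λ s _ → commute-εˡ s)
    , (λ a∈ b∈ → ∈centralizer⁺ λ s s∈ → commute-∙ˡ (∈centralizer⁻ a∈ s∈) (∈centralizer⁻ b∈ s∈))
    , (λ a∈ → ∈centralizer⁺ λ s s∈ → commute-⁻¹ˡ (∈centralizer⁻ a∈ s∈))

  centralizer-antitone : ∀ {S T} → S ⊆ T → centralizer T ⊆ centralizer S
  centralizer-antitone S⊆T x∈ = ∈centralizer⁺ λ s s∈ → ∈centralizer⁻ x∈ (S⊆T s∈)

  ⊆-centralizer² : ∀ {S} → S ⊆ centralizer (centralizer S)
  ⊆-centralizer² x∈ = ∈centralizer⁺ λ y y∈ → sym (∈centralizer⁻ y∈ x∈)

  center⊆centralizer : ∀ {S} → Z ⊆ centralizer S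
  center⊆centralizer z∈ = ∈centralizer⁺ λ s _ → ∈center⁻ z∈ s

  centralizer²-isAbelianSubgroup : ∀ {S} → S ⊆ centralizer S →
                                   IsAbelianSubgroup Γ (centralizer (centralizer S))
  centralizer²-isAbelianSubgroup S⊆CS =
    centralizer-isSubgroup _ , λ a∈ b∈ → ∈centralizer⁻ a∈ (centralizer-antitone S⊆CS b∈)

  isAbelianSubgroup? : ∀ H → Dec (IsAbelianSubgroup Γ H)
  isAbelianSubgroup? H =
    ((ε ∈? H) ×-dec ∀₂? (λ a b → a ∈? H →-dec b ∈? H →-dec (a ∙ b) ∈? H)
              ×-dec ∀₁? (λ a → a ∈? H →-dec (a ⁻¹) ∈? H))
    ×-dec ∀₂? (λ a b → a ∈? H →-dec b ∈? H →-dec Commute? a b)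
    where
    ∀₁? : {R : Fin n → Set} → (∀ a → Dec (R a)) → Dec (∀ {a} → R a)
    ∀₁? R? = map′ (λ f {a} → f a) (λ f a → f) (all? R?)
    ∀₂? : {R : Fin n → Fin n → Set} → (∀ a b → Dec (R a b)) → Dec (∀ {a b} → R a b)
    ∀₂? R? = map′ (λ f {a} {b} → f a b) (λ f a b → f) (all? λ a → all? (R? a))

  private
    extendToMaximal : ∀ H → Acc _<_ (n ∸ ∣ H ∣) → IsAbelianSubgroup Γ H →
                      ∃ λ B → IsMaximalAbelian Γ B × H ⊆ B
    extendToMaximal H (acc rs) abH with anySubset? (λ K → isAbelianSubgroup? K ×-dec H ⊂? K)
    ... | yes (K , abK , H⊂K@(H⊆K , _)) with extendToMaximal K (rs (∸-monoʳ-< (p⊂q⇒∣p∣<∣q∣ H⊂K) (∣p∣≤n K))) abK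
    ...   | B , maxB , K⊆B = B , maxB , λ x∈ → K⊆B (H⊆K x∈)
    extendToMaximal H _ abH | no ∄K = H , (abH , maximal) , λ x∈ → x∈
      where
      maximal : ∀ K → IsAbelianSubgroup Γ K → H ⊆ K → K ≡ H
      maximal K abK H⊆K = ⊆-antisym K⊆H H⊆K
        where
        K⊆H : K ⊆ H
        K⊆H {x} x∈K = decidable-stable (x ∈? H) λ x∉H → ∄K (K , abK , H⊆K , x , x∈K , x∉H)

  abelianSubgroup⊆maximal : ∀ {H} → IsAbelianSubgroup Γ H → ∃ λ B → IsMaximalAbelian Γ B × H ⊆ B
  abelianSubgroup⊆maximal = extendToMaximal _ (<-wellFounded _)

  ⁅⁆⊆centralizer : ∀ x → ⁅ x ⁆ ⊆ centralizer ⁅ x ⁆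
  ⁅⁆⊆centralizer x s∈ = ∈centralizer⁺ λ t t∈ →
    subst₂ (Commute Γ) (sym (x∈⁅y⁆⇒x≡y x s∈)) (sym (x∈⁅y⁆⇒x≡y x t∈)) refl

  pair⊆centralizer : ∀ {x w} → Commute Γ x w → ⁅ x ⁆ ∪ ⁅ w ⁆ ⊆ centralizer (⁅ x ⁆ ∪ ⁅ w ⁆)
  pair⊆centralizer {x} {w} xw s∈ = ∈centralizer⁺ λ t t∈ → commute (∈pair s∈) (∈pair t∈)
    where
    ∈pair : ∀ {s} → s ∈ ⁅ x ⁆ ∪ ⁅ w ⁆ → s ≡ x ⊎ s ≡ w
    ∈pair s∈ = Sum.map (x∈⁅y⁆⇒x≡y x) (x∈⁅y⁆⇒x≡y w) (x∈p∪q⁻ ⁅ x ⁆ ⁅ w ⁆ s∈)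
    commute : ∀ {s t} → s ≡ x ⊎ s ≡ w → t ≡ x ⊎ t ≡ w → Commute Γ s t
    commute (inj₁ refl) (inj₁ refl) = refl
    commute (inj₁ refl) (inj₂ refl) = xw
    commute (inj₂ refl) (inj₁ refl) = sym xw
    commute (inj₂ refl) (inj₂ refl) = refl

  commutingPair⊆maximal : ∀ {x w} → Commute Γ x w → ∃ λ B → IsMaximalAbelian Γ B × x ∈ B × w ∈ B
  commutingPair⊆maximal xw
    with abelianSubgroup⊆maximal (centralizer²-isAbelianSubgroup (pair⊆centralizer xw))
  ... | B , maxB , sub = B , maxB , sub (⊆-centralizer² (x∈p∪q⁺ (inj₁ (x∈⁅x⁆ _))))
                                  , sub (⊆-centralizer² (x∈p∪q⁺ (inj₂ (x∈⁅x⁆ _))))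

  maximalAbelian-hasNoncentral : ∀ {a A} → a ∉ Z → IsMaximalAbelian Γ A → ∃ λ x → x ∈ A × x ∉ Z
  maximalAbelian-hasNoncentral {a} {A} a∉Z (_ , maximal)
    with any? (λ x → x ∈? A ×-dec ¬? (x ∈? Z))
  ... | yes found = found
  ... | no none = ⊥-elim (a∉Z (A⊆Z (subst (a ∈_) K≡A (⊆-centralizer² (x∈⁅x⁆ a)))))
    where
    A⊆Z : A ⊆ Z
    A⊆Z {x} x∈A = decidable-stable (x ∈? Z) λ x∉Z → none (x , x∈A , x∉Z)
    -- A ⊆ Z ⊆ C(C(⁅ a ⁆)), an abelian subgroup, so maximality of A makes them equal
    K≡A : centralizer (centralizer ⁅ a ⁆) ≡ A
    K≡A = maximal _ (centralizer²-isAbelianSubgroup (⁅⁆⊆centralizer a))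
                    (λ x∈A → center⊆centralizer (A⊆Z x∈A))

MaximalAbeliansMeetInCenter : ∀ {n} → FinGroup n → Set
MaximalAbeliansMeetInCenter Γ =
  ∀ A B → IsMaximalAbelian Γ A → IsMaximalAbelian Γ B → A ≢ B → A ∩ B ≡ center Γ

module _ {n : ℕ} (Γ : FinGroup n) (meet : MaximalAbeliansMeetInCenter Γ) where

  ∈distinctMaximal⇒∈center : ∀ {A B x} → IsMaximalAbelian Γ A → IsMaximalAbelian Γ B → A ≢ B →
                             x ∈ A → x ∈ B → x ∈ center Γ
  ∈distinctMaximal⇒∈center maxA maxB A≢B x∈A x∈B =
    subst (_ ∈_) (meet _ _ maxA maxB A≢B) (x∈p∩q⁺ (x∈A , x∈B))

  maximal-closedUnderCommuting : ∀ {A x w} → IsMaximalAbelian Γ A → x ∈ A → x ∉ center Γ →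
                                 Commute Γ x w → w ∈ A
  maximal-closedUnderCommuting {A} {x} {w} maxA x∈A x∉Z xw with commutingPair⊆maximal Γ xw
  ... | B , maxB , x∈B , w∈B = decidable-stable (w ∈? A) λ w∉A →
    x∉Z (∈distinctMaximal⇒∈center maxA maxB (λ { refl → w∉A w∈B }) x∈A x∈B)

module _ {n : ℕ} {Adj : Fin n → Fin n → Set} where
  open EdgeColouring using (colour)

  ¬rainbowColourable₀ : Fin n → ¬ RainbowColourable Adj 0
  ¬rainbowColourable₀ v (c , _) with colour c v v
  ... | ()

  rainbowWalk₁ : (c : EdgeColouring Adj 1) → ∀ {u v} (p : Walk Adj u v) →
                 Unique (edgeColours Adj c p) → u ≡ v ⊎ Adj u v
  rainbowWalk₁ c nil                 _      = inj₁ refl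
  rainbowWalk₁ c (cons e nil)        _      = inj₂ e
  rainbowWalk₁ c (cons _ (cons _ _)) unique with Unique⇒length≤ unique
  ... | s≤s ()

  rainbowWalk₂ : (c : EdgeColouring Adj 2) → ∀ {u v} (p : Walk Adj u v) →
                 Unique (edgeColours Adj c p) →
                 u ≡ v ⊎ Adj u v ⊎ ∃ λ w → Adj u w × Adj w v × colour c u w ≢ colour c w v
  rainbowWalk₂ c nil                           _                  = inj₁ refl
  rainbowWalk₂ c (cons e nil)                  _                  = inj₂ (inj₁ e)
  rainbowWalk₂ c (cons e (cons f nil))         ((c₁≢c₂ ∷ []) ∷ _) = inj₂ (inj₂ (_ , e , f , c₁≢c₂))
  rainbowWalk₂ c (cons _ (cons _ (cons _ _))) unique with Unique⇒length≤ unique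
  ... | s≤s (s≤s ())

  ¬rainbowColourable₁ : ∀ {u v} → u ≢ v → ¬ Adj u v → ¬ RainbowColourable Adj 1
  ¬rainbowColourable₁ u≢v ¬uv (c , connect) with connect _ _ u≢v
  ... | p , _ , unique with rainbowWalk₁ c p unique
  ...   | inj₁ u≡v = u≢v u≡v
  ...   | inj₂ uv  = ¬uv uv

  path₁-isRainbow : ∀ {k} (c : EdgeColouring Adj k) {u v} → u ≢ v → (e : Adj u v) →
                    IsRainbowPath Adj c (cons e nil)
  path₁-isRainbow c u≢v e = ((u≢v ∷ []) ∷ [] ∷ []) , ([] ∷ [])

  path₂-isRainbow : ∀ {k} (c : EdgeColouring Adj k) {u w v} (e₁ : Adj u w) (e₂ : Adj w v) →
                    u ≢ w → u ≢ v → w ≢ v → colour c u w ≢ colour c w v →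
                    IsRainbowPath Adj c (cons e₁ (cons e₂ nil))
  path₂-isRainbow c e₁ e₂ u≢w u≢v w≢v c₁≢c₂ =
    ((u≢w ∷ u≢v ∷ []) ∷ (w≢v ∷ []) ∷ [] ∷ []) , ((c₁≢c₂ ∷ []) ∷ [] ∷ [])

  path₃-isRainbow : ∀ {k} (c : EdgeColouring Adj k) {u w x v}
                    (e₁ : Adj u w) (e₂ : Adj w x) (e₃ : Adj x v) →
                    u ≢ w → u ≢ x → u ≢ v → w ≢ x → w ≢ v → x ≢ v →
                    colour c u w ≢ colour c w x → colour c u w ≢ colour c x v →
                    colour c w x ≢ colour c x v →
                    IsRainbowPath Adj c (cons e₁ (cons e₂ (cons e₃ nil)))
  path₃-isRainbow c e₁ e₂ e₃ u≢w u≢x u≢v w≢x w≢v x≢v c₁≢c₂ c₁≢c₃ c₂≢c₃ =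
      ((u≢w ∷ u≢x ∷ u≢v ∷ []) ∷ (w≢x ∷ w≢v ∷ []) ∷ (x≢v ∷ []) ∷ [] ∷ [])
    , ((c₁≢c₂ ∷ c₁≢c₃ ∷ []) ∷ (c₂≢c₃ ∷ []) ∷ [] ∷ [])

  rcIs-twoOrThree : ¬ RainbowColourable Adj 0 → ¬ RainbowColourable Adj 1 →
                    RainbowColourable Adj 3 →
                    (RcIs Adj 2 ⇔ RainbowColourable Adj 2) × (RcIs Adj 3 ⇔ (¬ RainbowColourable Adj 2))
  rcIs-twoOrThree ¬rc₀ ¬rc₁ rc₃ =
      mk⇔ proj₁ (λ rc₂ → rc₂ , below₂)
    , mk⇔ (λ (_ , below) → below 2 (s≤s (s≤s (s≤s z≤n)))) (λ ¬rc₂ → rc₃ , below₃ ¬rc₂)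
    where
    below₂ : ∀ m → m < 2 → ¬ RainbowColourable Adj m
    below₂ zero          _                = ¬rc₀
    below₂ (suc zero)    _                = ¬rc₁
    below₂ (suc (suc _)) (s≤s (s≤s ()))
    below₃ : ¬ RainbowColourable Adj 2 → ∀ m → m < 3 → ¬ RainbowColourable Adj m
    below₃ ¬rc₂ zero                _                     = ¬rc₀
    below₃ ¬rc₂ (suc zero)          _                     = ¬rc₁
    below₃ ¬rc₂ (suc (suc zero))    _                     = ¬rc₂
    below₃ ¬rc₂ (suc (suc (suc _))) (s≤s (s≤s (s≤s ())))

module _ {n : ℕ} (Γ : FinGroup n) {𝒞 : List (Subset n)} (enum : EnumeratesMaxAbelian Γ 𝒞) where

  lookup-isMaximalAbelian : ∀ i → IsMaximalAbelian Γ (lookup 𝒞 i)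
  lookup-isMaximalAbelian i = Equivalence.to (proj₂ enum _) (∈-lookup i)

  ∈someMaximalAbelian : ∀ x → ∃ λ i → x ∈ lookup 𝒞 i
  ∈someMaximalAbelian x with commutingPair⊆maximal Γ {x} refl
  ... | B , maxB , x∈B , _ = index B∈𝒞 , subst (x ∈_) (lookup-index B∈𝒞) x∈B
    where B∈𝒞 = Equivalence.from (proj₂ enum B) maxB

module _ {n : ℕ} (Γ : FinGroup n) where
  open FinGroup Γ
  open EdgeColouring using (colour)

  private
    Z : Subset n
    Z = center Γ

    central? : Fin n → Bool
    central? x = does (x ∈? Z)

  noncentral-adjacent-central : ∀ {u z} → u ∉ Z → z ∈ Z → CGAdj Γ u z
  noncentral-adjacent-central u∉Z z∈Z = ∉center⇒≢∈center Γ u∉Z z∈Z , sym (∈center⁻ Γ z∈Z _)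

  CGAdj-sym : ∀ {a b} → CGAdj Γ a b → CGAdj Γ b a
  CGAdj-sym (a≢b , ab) = (a≢b ∘ sym) , sym ab

  threeColourable : ∃ (λ z → z ∈ Z × z ≢ ε) → RainbowColourable (CGAdj Γ) 3
  threeColourable (z , z∈Z , z≢ε) = c , connect
    where
    isε : Fin n → Bool
    isε x = does (x ≟ ε)

    -- for noncentral u, v the path u – ε – z – v is coloured 1, 0, 2
    colour₃ : Fin n → Fin n → Fin 3
    colour₃ a b = if central? a ∧ central? b then zero
                  else if isε a ∨ isε b then suc zero else suc (suc zero)

    colour₃-sym : ∀ a b → colour₃ a b ≡ colour₃ b a
    colour₃-sym a b rewrite ∧-comm (central? a) (central? b) | ∨-comm (isε a) (isε b) = refl

    c : EdgeColouring (CGAdj Γ) 3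
    c = record { colour = colour₃ ; sym = colour₃-sym }

    connect : IsRainbowConnecting (CGAdj Γ) c
    connect u v u≢v with Commute? Γ u v
    ... | yes uv = cons (u≢v , uv) nil , path₁-isRainbow c u≢v (u≢v , uv)
    ... | no ¬uv =
      cons u–ε (cons ε–z (cons z–v nil)) ,
      path₃-isRainbow c u–ε ε–z z–v u≢ε u≢z u≢v ε≢z ε≢v z≢v
        (subst₂ _≢_ (sym uε) (sym εz) λ ()) (subst₂ _≢_ (sym uε) (sym zv) λ ())
        (subst₂ _≢_ (sym εz) (sym zv) λ ())
      where
      u∉Z : u ∉ Z
      u∉Z = ¬commute⇒∉center Γ ¬uv
      v∉Z : v ∉ Z
      v∉Z = ¬commute⇒∉center Γ (¬uv ∘ sym)
      u≢ε : u ≢ ε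
      u≢ε = ∉center⇒≢∈center Γ u∉Z (ε∈center Γ)
      u≢z : u ≢ z
      u≢z = ∉center⇒≢∈center Γ u∉Z z∈Z
      ε≢z : ε ≢ z
      ε≢z = z≢ε ∘ sym
      ε≢v : ε ≢ v
      ε≢v = ∉center⇒≢∈center Γ v∉Z (ε∈center Γ) ∘ sym
      z≢v : z ≢ v
      z≢v = ∉center⇒≢∈center Γ v∉Z z∈Z ∘ sym
      u–ε : CGAdj Γ u ε
      u–ε = noncentral-adjacent-central u∉Z (ε∈center Γ)
      ε–z : CGAdj Γ ε z
      ε–z = ε≢z , commute-εˡ Γ z
      z–v : CGAdj Γ z v
      z–v = CGAdj-sym (noncentral-adjacent-central v∉Z z∈Z)
      uε : colour₃ u ε ≡ suc zero
      uε rewrite dec-false (u ∈? Z) u∉Z | dec-false (u ≟ ε) u≢ε | dec-true (ε ≟ ε) refl = refl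
      εz : colour₃ ε z ≡ zero
      εz rewrite dec-true (ε ∈? Z) (ε∈center Γ) | dec-true (z ∈? Z) z∈Z = refl
      zv : colour₃ z v ≡ suc (suc zero)
      zv rewrite dec-true (z ∈? Z) z∈Z | dec-false (v ∈? Z) v∉Z
               | dec-false (z ≟ ε) z≢ε | dec-false (v ≟ ε) (ε≢v ∘ sym) = refl

  twoColourable : ∀ {𝒞} → EnumeratesMaxAbelian Γ 𝒞 → length 𝒞 ≤ 2 ^ ∣ Z ∣ →
                  RainbowColourable (CGAdj Γ) 2
  twoColourable {𝒞} enum fits = c , connect
    where
    class : Fin n → Fin (length 𝒞)
    class x = proj₁ (∈someMaximalAbelian Γ enum x)

    -- the maximal abelian subgroup containing x, encoded as a 2-colouring of Z
    signature : Fin n → Fin n → Fin 2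
    signature x = decodeOn Z (inject≤ (class x) fits)

    across : Bool → Bool → Fin n → Fin n → Fin 2
    across false false a b = zero
    across false true  a b = signature a b
    across true  false a b = signature b a
    across true  true  a b = zero

    across-sym : ∀ s t a b → across s t a b ≡ across t s b a
    across-sym false false a b = refl
    across-sym false true  a b = refl
    across-sym true  false a b = refl
    across-sym true  true  a b = refl

    c : EdgeColouring (CGAdj Γ) 2
    c = record { colour = λ a b → across (central? a) (central? b) a b
               ; sym    = λ a b → across-sym (central? a) (central? b) a b }

    sameClass⇒commute : ∀ {u v} → class u ≡ class v → Commute Γ u v
    sameClass⇒commute {u} {v} same =
      proj₂ (proj₁ (lookup-isMaximalAbelian Γ enum (class v)))
            (subst (λ i → u ∈ lookup 𝒞 i) same (proj₂ (∈someMaximalAbelian Γ enum u)))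
            (proj₂ (∈someMaximalAbelian Γ enum v))

    viaCenter : ∀ {u v z} → ¬ Commute Γ u v → z ∈ Z → signature u z ≢ signature v z →
                Σ (Walk (CGAdj Γ) u v) (IsRainbowPath (CGAdj Γ) c)
    viaCenter {u} {v} {z} ¬uv z∈Z signatures≢ =
      cons u–z (cons z–v nil) , path₂-isRainbow c u–z z–v (proj₁ u–z) (¬commute⇒≢ Γ ¬uv) (proj₁ z–v)
                                  (subst₂ _≢_ (sym uz) (sym zv) signatures≢)
      where
      u∉Z : u ∉ Z
      u∉Z = ¬commute⇒∉center Γ ¬uv
      v∉Z : v ∉ Z
      v∉Z = ¬commute⇒∉center Γ (¬uv ∘ sym)
      u–z : CGAdj Γ u z
      u–z = noncentral-adjacent-central u∉Z z∈Z
      z–v : CGAdj Γ z v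
      z–v = CGAdj-sym (noncentral-adjacent-central v∉Z z∈Z)
      uz : across (central? u) (central? z) u z ≡ signature u z
      uz = cong₂ (λ s t → across s t u z) (dec-false (u ∈? Z) u∉Z) (dec-true (z ∈? Z) z∈Z)
      zv : across (central? z) (central? v) z v ≡ signature v z
      zv = cong₂ (λ s t → across s t z v) (dec-true (z ∈? Z) z∈Z) (dec-false (v ∈? Z) v∉Z)

    connect : IsRainbowConnecting (CGAdj Γ) c
    connect u v u≢v with Commute? Γ u v
    ... | yes uv = cons (u≢v , uv) nil , path₁-isRainbow c u≢v (u≢v , uv)
    ... | no ¬uv =
      let z , z∈Z , signatures≢ =
            decodeOn-separates Z (¬uv ∘ sameClass⇒commute ∘ inject≤-injective fits fits (class u) (class v))
      in viaCenter ¬uv z∈Z signatures≢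

  twoColourable⇒fits : ¬ IsAbelianGroup Γ → MaximalAbeliansMeetInCenter Γ →
                       ∀ {𝒞} → EnumeratesMaxAbelian Γ 𝒞 →
                       RainbowColourable (CGAdj Γ) 2 → length 𝒞 ≤ 2 ^ ∣ Z ∣
  twoColourable⇒fits nonabelian meet {𝒞} enum (c , connect) = injective⇒≤ signature-injective
    where
    A : Fin (length 𝒞) → Subset n
    A = lookup 𝒞

    maxAbelian : ∀ i → IsMaximalAbelian Γ (A i)
    maxAbelian = lookup-isMaximalAbelian Γ enum

    representative : ∀ i → ∃ λ x → x ∈ A i × x ∉ Z
    representative i =
      maximalAbelian-hasNoncentral Γ (proj₂ (nonabelian⇒noncentral Γ nonabelian)) (maxAbelian i)

    x : Fin (length 𝒞) → Fin n
    x i = proj₁ (representative i)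

    signature : Fin (length 𝒞) → Fin (2 ^ ∣ Z ∣)
    signature i = encodeOn Z (colour c (x i))

    absorbs : ∀ {i w} → Commute Γ (x i) w → w ∈ A i
    absorbs {i} = maximal-closedUnderCommuting Γ meet (maxAbelian i)
                    (proj₁ (proj₂ (representative i))) (proj₂ (proj₂ (representative i)))

    shared⇒central : ∀ {i j w} → i ≢ j → w ∈ A i → w ∈ A j → w ∈ Z
    shared⇒central {i} {j} i≢j = ∈distinctMaximal⇒∈center Γ meet (maxAbelian i) (maxAbelian j)
                                   (i≢j ∘ lookup-injective (proj₁ enum))

    ¬commute : ∀ {i j} → i ≢ j → ¬ Commute Γ (x i) (x j)
    ¬commute {i} {j} i≢j xixj =
      proj₂ (proj₂ (representative j)) (shared⇒central i≢j (absorbs xixj) (proj₁ (proj₂ (representative j))))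

    -- a 2-rainbow path from x i to x j has the form x i – w – x j with w central
    separated : ∀ {i j} → i ≢ j → signature i ≢ signature j
    separated {i} {j} i≢j same = noShortWalk (rainbowWalk₂ c p unique)
      where
      xi≢xj : x i ≢ x j
      xi≢xj = ¬commute⇒≢ Γ (¬commute i≢j)
      p : Walk (CGAdj Γ) (x i) (x j)
      p = proj₁ (connect (x i) (x j) xi≢xj)
      unique : Unique (edgeColours (CGAdj Γ) c p)
      unique = proj₂ (proj₂ (connect (x i) (x j) xi≢xj))
      noShortWalk : ¬ (x i ≡ x j ⊎ CGAdj Γ (x i) (x j) ⊎
                       ∃ λ w → CGAdj Γ (x i) w × CGAdj Γ w (x j) × colour c (x i) w ≢ colour c w (x j))
      noShortWalk (inj₁ xi≡xj)             = xi≢xj xi≡xj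
      noShortWalk (inj₂ (inj₁ (_ , xixj))) = ¬commute i≢j xixj
      noShortWalk (inj₂ (inj₂ (w , (_ , xiw) , (_ , wxj) , colours≢))) = colours≢ (begin
        colour c (x i) w  ≡⟨ encodeOn-injective Z {colour c (x i)} {colour c (x j)} same w∈Z ⟩
        colour c (x j) w  ≡⟨ EdgeColouring.sym c (x j) w ⟩
        colour c w (x j)  ∎)
        where
        open ≡-Reasoning
        w∈Z : w ∈ Z
        w∈Z = shared⇒central i≢j (absorbs xiw) (absorbs (sym wxj))

    signature-injective : ∀ {i j} → signature i ≡ signature j → i ≡ j
    signature-injective {i} {j} same = decidable-stable (i ≟ j) λ i≢j → separated i≢j same

corollary1 : ∀ {n} (Γ : FinGroup n)
    → ¬ IsAbelianGroup Γ
    → ∃ (λ z → z ∈ center Γ × z ≢ FinGroup.ε Γ)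
    → (∀ A B → IsMaximalAbelian Γ A → IsMaximalAbelian Γ B → A ≢ B → A ∩ B ≡ center Γ)
    → (𝒞 : List (Subset n)) → EnumeratesMaxAbelian Γ 𝒞
    → (RcIs (CGAdj Γ) 2 ⇔ length 𝒞 ≤ 2 ^ ∣ center Γ ∣)
    × (RcIs (CGAdj Γ) 3 ⇔ length 𝒞 > 2 ^ ∣ center Γ ∣)
corollary1 Γ nonabelian nontrivialCenter meet 𝒞 enum with nonabelian⇒noncommuting Γ nonabelian
... | a , b , ¬ab =
  let rc₂⇔rc₂ , rc₃⇔¬rc₂ = rcIs-twoOrThree (¬rainbowColourable₀ a)
                                            (¬rainbowColourable₁ (¬commute⇒≢ Γ ¬ab) (¬ab ∘ proj₂))
                                            (threeColourable Γ nontrivialCenter)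
  in ⇔.trans rc₂⇔rc₂ rc₂⇔fits , ⇔.trans rc₃⇔¬rc₂ ¬rc₂⇔exceeds
  where
  rc₂⇔fits : RainbowColourable (CGAdj Γ) 2 ⇔ length 𝒞 ≤ 2 ^ ∣ center Γ ∣
  rc₂⇔fits = mk⇔ (twoColourable⇒fits Γ nonabelian meet enum) (twoColourable Γ enum)

  ¬rc₂⇔exceeds : (¬ RainbowColourable (CGAdj Γ) 2) ⇔ length 𝒞 > 2 ^ ∣ center Γ ∣
  ¬rc₂⇔exceeds = mk⇔ (λ ¬rc₂ → ≰⇒> (¬rc₂ ∘ twoColourable Γ enum))
                     (λ exceeds → <⇒≱ exceeds ∘ twoColourable⇒fits Γ nonabelian meet enum)
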